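{- Let $n$ be a positive integer and let $\delta_1,\gamma_1$ be as defined in the context. The set $\mathcal{C}_n(\delta_1,\gamma_1)$ equals the set of coloured partitions $\lambda_1+\dots+\lambda_s$, each part coloured by some $a_ib_k$ with $0\le i,k\le n-1$ and $(i,k)\ne(0,0)$, such that $\lambda_j-\lambda_{j+1}\ge\Delta_1(c(\lambda_j),c(\lambda_{j+1}))$ for all $j\in\{1,\dots,s-1\}$, where $\Delta_1(a_ib_i,a_ib_i)=1$ for all $i>0$; $\Delta_1(a_\ell b_\ell,a_kb_{\ell-1})=1$ for all $k\ge\ell>0$; $\Delta_1(a_{k-1}b_\ell,a_kb_k)=1$ for all $\ell\ge k>0$; and $\Delta_1(c_1,c_2)=\Delta(c_1,c_2)$ otherwise; and which, for every positive integer $p$, avoid the patterns $(p+1)_{a_{k_1}b_{\ell_1}}+p_{a_{k_2}b_{k_2}}+p_{a_{k_2}b_{\ell_2}}$ for all $k_2>k_1>\ell_2\ge\ell_1$, and $(p+1)_{a_{k_1}b_{\ell_1}}+(p+1)_{a_{\ell_1}b_{\ell_1}}+p_{a_{k_2}b_{\ell_2}}$ for all $\ell_1>\ell_2>k_1\ge k_2$.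
   Context: Colours are symbols $a_ib_k$ with $0\le i,k\le n-1$; $a_ib_i$ is free, $a_ib_k$ ($i\ne k$) bound. With $\chi(P)\in\{0,1\}$ the truth value of $P$, $\Delta(a_ib_k,a_{i'}b_{k'})=\chi(i\ge i')-\chi(i=k=i')+\chi(k\le k')-\chi(k=i'=k')$. $\mathcal{P}_n$ is the set of coloured partitions $\lambda_1+\dots+\lambda_s$ (positive integer parts, colours $c(\lambda_j)$) with $\lambda_j-\lambda_{j+1}\ge\Delta(c(\lambda_j),c(\lambda_{j+1}))$. Write $p_c$ for a part $p$ of colour $c$; $\lambda$ contains the pattern $\pi_1+\dots+\pi_r$ if $\lambda_i=\pi_1,\dots,\lambda_{i+r-1}=\pi_r$ (as coloured parts) for some $i$. For given functions $\delta$ (on bound colours) and $\gamma$ (on pairs of bound colours), $\mathcal{C}_n(\delta,\gamma)$ is the set of $\lambda\in\mathcal{P}_n$ with no part coloured $a_0b_0$ avoiding, for every positive integer $p$: (a) $p_{a_ib_i}+p_{a_ib_i}$, $1\le i\le n-1$; (b) $p_{a_{k_1}b_{\ell_1}}+p_{a_ib_i}+p_{a_{k_2}b_{\ell_2}}$ when $\max\{k_1,\ell_2\}<\min\{k_2,\ell_1\}$, $i=\gamma(a_{k_1}b_{\ell_1},a_{k_2}b_{\ell_2})$; (c) for $k_2>\ell_2$: (c1) $(p+u)_{a_{k_1}b_{\ell_1}}+p_{a_ib_i}+p_{a_{k_2}b_{\ell_2}}$ for any $2\le u\le\infty$, any $k_1,\ell_1$, $i=\delta(a_{k_2}b_{\ell_2})$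 ($u=\infty$ meaning $p_{a_ib_i}+p_{a_{k_2}b_{\ell_2}}$ begins the partition); (c2) $(p+1)_{a_{k_1}b_{\ell_1}}+p_{a_ib_i}+p_{a_{k_2}b_{\ell_2}}$ for $k_1\le\ell_1$, $i=\delta(a_{k_2}b_{\ell_2})$; (c3) the same pattern for $k_1>\ell_1$ with $\{\ell_2+1,\dots,k_2\}\setminus\{\ell_1+1,\dots,k_1\}\ne\emptyset$, $i=\gamma(a_{k_1}b_{\ell_1},a_{k_2}b_{\ell_2})$; (d) for $k_1<\ell_1$: (d1) $p_{a_{k_1}b_{\ell_1}}+p_{a_ib_i}+(p-u)_{a_{k_2}b_{\ell_2}}$ for any $2\le u\le\infty$, any $k_2,\ell_2$, $i=\delta(a_{k_1}b_{\ell_1})$ ($u=\infty$ meaning $p_{a_{k_1}b_{\ell_1}}+p_{a_ib_i}$ ends the partition); (d2) $(p+1)_{a_{k_1}b_{\ell_1}}+(p+1)_{a_ib_i}+p_{a_{k_2}b_{\ell_2}}$ for $k_2\ge\ell_2$, $i=\delta(a_{k_1}b_{\ell_1})$; (d3) the same pattern for $k_2<\ell_2$ with $\{k_1+1,\dots,\ell_1\}\setminus\{k_2+1,\dots,\ell_2\}\ne\emptyset$, $i=\gamma(a_{k_1}b_{\ell_1},a_{k_2}b_{\ell_2})$. Here $\delta_1(a_kb_\ell)=1+\min\{k,\ell\}$ for $k\ne\ell$, and $\gamma_1$ is defined by: for $\max\{k_1,\ell_2\}<\min\{k_2,\ell_1\}$, $\gamma_1(a_{k_1}b_{\ell_1},a_{k_2}b_{\ell_2})=1+\max\{k_1,\ell_2\}$;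 for $k_1>\ell_1$, $k_2>\ell_2$ with $D:=\{\ell_2+1,\dots,k_2\}\setminus\{\ell_1+1,\dots,k_1\}\ne\emptyset$, $\gamma_1=\ell_2+1$ if $\ell_2+1\in D$ and $k_2$ otherwise; for $k_1<\ell_1$, $k_2<\ell_2$ with $E:=\{k_1+1,\dots,\ell_1\}\setminus\{k_2+1,\dots,\ell_2\}\ne\emptyset$, $\gamma_1=k_1+1$ if $k_1+1\in E$ and $\ell_1$ otherwise. -}

module Defs where

open import Data.Nat using (ℕ; zero; suc; _+_; _∸_; _≤_; _<_; _⊔_; _⊓_; _≡ᵇ_; _<ᵇ_; _≤ᵇ_)
open import Data.Bool using (Bool; true; false; if_then_else_; _∧_; not)
open import Data.Product using (_×_; _,_; ∃; ∃₂; Σ)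
open import Data.List using (List; []; _∷_; _++_)
open import Data.List.Relation.Unary.All using (All)
open import Data.List.Relation.Unary.Linked using (Linked)
open import Relation.Binary.PropositionalEquality using (_≡_)
open import Relation.Nullary using (¬_)

-- The colour a_i b_k is represented by the pair (i , k).
Colour : Set
Colour = ℕ × ℕ

-- A coloured part p_{a_i b_k} is represented by (p , i , k).
Part : Set
Part = ℕ × Colour

size : Part → ℕ
size (p , _) = p

colour : Part → Colour
colour (_ , c) = c

-- A coloured partition λ_1 + ... + λ_s is the list [λ_1, ..., λ_s].
Partition : Set
Partition = List Part

χ : Bool → ℕ
χ true  = 1
χ false = 0

-- Δ(a_i b_k, a_i' b_k')
--   = (χ(i ≥ i') − χ(i = k = i')) + (χ(k ≤ k') − χ(k = i' = k')).
-- Each bracket is already ≥ 0 (i = k = i' implies i ≥ i', and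
-- k = i' = k' implies k ≤ k'), so truncated subtraction is exact.
Δ : Colour → Colour → ℕ
Δ (i , k) (i' , k') =
  (χ (i' ≤ᵇ i) ∸ χ ((i ≡ᵇ k) ∧ (k ≡ᵇ i')))
  + (χ (k ≤ᵇ k') ∸ χ ((k ≡ᵇ i') ∧ (i' ≡ᵇ k')))

ValidColour : ℕ → Colour → Set
ValidColour n (i , k) = i < n × k < n

DiffCond : (Colour → Colour → ℕ) → Part → Part → Set
DiffCond D x y = size y + D (colour x) (colour y) ≤ size x

InP : ℕ → Partition → Set
InP n ps =
  All (λ x → 1 ≤ size x × ValidColour n (colour x)) ps
  × Linked (DiffCond Δ) ps

Contains : Partition → List Part → Set
Contains ps π = ∃₂ λ xs ys → ps ≡ xs ++ π ++ ys

Begins : Partition → List Part → Set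
Begins ps π = ∃ λ ys → ps ≡ π ++ ys

Ends : Partition → List Part → Set
Ends ps π = ∃ λ xs → ps ≡ xs ++ π

DiffNonEmpty : ℕ → ℕ → ℕ → ℕ → Set
DiffNonEmpty a b c d = ∃ λ j → a < j × j ≤ b × ¬ (c < j × j ≤ d)

-- The set 𝒞_n(δ, γ).  δ(a_k b_ℓ) is written δ k ℓ and
-- γ(a_{k1} b_{ℓ1}, a_{k2} b_{ℓ2}) is written γ k1 ℓ1 k2 ℓ2.

module _ (δ : ℕ → ℕ → ℕ) (γ : ℕ → ℕ → ℕ → ℕ → ℕ) (ps : Partition) where

  AvoidA : Set
  AvoidA = ∀ p i → 1 ≤ p → 1 ≤ i →
    ¬ Contains ps ((p , i , i) ∷ (p , i , i) ∷ [])

  AvoidB : Set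
  AvoidB = ∀ p k₁ ℓ₁ k₂ ℓ₂ → 1 ≤ p → (k₁ ⊔ ℓ₂) < (k₂ ⊓ ℓ₁) →
    ¬ Contains ps ((p , k₁ , ℓ₁) ∷ (p , γ k₁ ℓ₁ k₂ ℓ₂ , γ k₁ ℓ₁ k₂ ℓ₂)
                   ∷ (p , k₂ , ℓ₂) ∷ [])

  -- (c1), finite u ≥ 2: the first part is q = p + u
  AvoidC1 : Set
  AvoidC1 = ∀ p q (c : Colour) k₂ ℓ₂ → 1 ≤ p → ℓ₂ < k₂ → p + 2 ≤ q →
    ¬ Contains ps ((q , c) ∷ (p , δ k₂ ℓ₂ , δ k₂ ℓ₂) ∷ (p , k₂ , ℓ₂) ∷ [])

  -- (c1), u = ∞
  AvoidC1∞ : Set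
  AvoidC1∞ = ∀ p k₂ ℓ₂ → 1 ≤ p → ℓ₂ < k₂ →
    ¬ Begins ps ((p , δ k₂ ℓ₂ , δ k₂ ℓ₂) ∷ (p , k₂ , ℓ₂) ∷ [])

  AvoidC2 : Set
  AvoidC2 = ∀ p k₁ ℓ₁ k₂ ℓ₂ → 1 ≤ p → ℓ₂ < k₂ → k₁ ≤ ℓ₁ →
    ¬ Contains ps ((suc p , k₁ , ℓ₁) ∷ (p , δ k₂ ℓ₂ , δ k₂ ℓ₂)
                   ∷ (p , k₂ , ℓ₂) ∷ [])

  AvoidC3 : Set
  AvoidC3 = ∀ p k₁ ℓ₁ k₂ ℓ₂ → 1 ≤ p → ℓ₂ < k₂ → ℓ₁ < k₁ →
    DiffNonEmpty ℓ₂ k₂ ℓ₁ k₁ →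
    ¬ Contains ps ((suc p , k₁ , ℓ₁) ∷ (p , γ k₁ ℓ₁ k₂ ℓ₂ , γ k₁ ℓ₁ k₂ ℓ₂)
                   ∷ (p , k₂ , ℓ₂) ∷ [])

  -- (d1), finite u ≥ 2: the last part is q = p − u
  AvoidD1 : Set
  AvoidD1 = ∀ p q k₁ ℓ₁ (c : Colour) → 1 ≤ p → k₁ < ℓ₁ → q + 2 ≤ p →
    ¬ Contains ps ((p , k₁ , ℓ₁) ∷ (p , δ k₁ ℓ₁ , δ k₁ ℓ₁) ∷ (q , c) ∷ [])

  -- (d1), u = ∞
  AvoidD1∞ : Set
  AvoidD1∞ = ∀ p k₁ ℓ₁ → 1 ≤ p → k₁ < ℓ₁ →
    ¬ Ends ps ((p , k₁ , ℓ₁) ∷ (p , δ k₁ ℓ₁ , δ k₁ ℓ₁) ∷ [])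

  AvoidD2 : Set
  AvoidD2 = ∀ p k₁ ℓ₁ k₂ ℓ₂ → 1 ≤ p → k₁ < ℓ₁ → ℓ₂ ≤ k₂ →
    ¬ Contains ps ((suc p , k₁ , ℓ₁) ∷ (suc p , δ k₁ ℓ₁ , δ k₁ ℓ₁)
                   ∷ (p , k₂ , ℓ₂) ∷ [])

  AvoidD3 : Set
  AvoidD3 = ∀ p k₁ ℓ₁ k₂ ℓ₂ → 1 ≤ p → k₁ < ℓ₁ → k₂ < ℓ₂ →
    DiffNonEmpty k₁ ℓ₁ k₂ ℓ₂ →
    ¬ Contains ps ((suc p , k₁ , ℓ₁) ∷ (suc p , γ k₁ ℓ₁ k₂ ℓ₂ , γ k₁ ℓ₁ k₂ ℓ₂)
                   ∷ (p , k₂ , ℓ₂) ∷ [])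

InC : ℕ → (ℕ → ℕ → ℕ) → (ℕ → ℕ → ℕ → ℕ → ℕ) → Partition → Set
InC n δ γ ps =
  InP n ps
  × All (λ x → ¬ (colour x ≡ (0 , 0))) ps
  × AvoidA δ γ ps × AvoidB δ γ ps
  × AvoidC1 δ γ ps × AvoidC1∞ δ γ ps × AvoidC2 δ γ ps × AvoidC3 δ γ ps
  × AvoidD1 δ γ ps × AvoidD1∞ δ γ ps × AvoidD2 δ γ ps × AvoidD3 δ γ ps

δ₁ : ℕ → ℕ → ℕ
δ₁ k ℓ = 1 + (k ⊓ ℓ)

inRange : ℕ → ℕ → ℕ → Bool
inRange j a b = (a <ᵇ j) ∧ (j ≤ᵇ b)

-- γ₁ as in the paper on its three (disjoint) domains; the value 0
-- elsewhere is an arbitrary filler and is never used.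
γ₁ : ℕ → ℕ → ℕ → ℕ → ℕ
γ₁ k₁ ℓ₁ k₂ ℓ₂ =
  if (k₁ ⊔ ℓ₂) <ᵇ (k₂ ⊓ ℓ₁) then 1 + (k₁ ⊔ ℓ₂)
  else if (ℓ₁ <ᵇ k₁) ∧ (ℓ₂ <ᵇ k₂) then
    -- ℓ₂+1 ∈ D = {ℓ₂+1..k₂} \ {ℓ₁+1..k₁}  (ℓ₂+1 ≤ k₂ holds here)
    (if not (inRange (suc ℓ₂) ℓ₁ k₁) then suc ℓ₂ else k₂)
  else if (k₁ <ᵇ ℓ₁) ∧ (k₂ <ᵇ ℓ₂) then
    -- k₁+1 ∈ E = {k₁+1..ℓ₁} \ {k₂+1..ℓ₂}  (k₁+1 ≤ ℓ₁ holds here)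
    (if not (inRange (suc k₁) k₂ ℓ₂) then suc k₁ else ℓ₁)
  else 0

Δ₁ : Colour → Colour → ℕ
Δ₁ (i , k) (i' , k') =
  if (i ≡ᵇ k) ∧ (i' ≡ᵇ k') ∧ (i ≡ᵇ i') ∧ (0 <ᵇ i) then 1
  -- Δ₁(a_ℓ b_ℓ, a_k b_{ℓ-1}) = 1, k ≥ ℓ > 0
  else if (i ≡ᵇ k) ∧ (0 <ᵇ i) ∧ (suc k' ≡ᵇ i) ∧ (i ≤ᵇ i') then 1
  -- Δ₁(a_{k-1} b_ℓ, a_k b_k) = 1, ℓ ≥ k > 0
  else if (i' ≡ᵇ k') ∧ (0 <ᵇ i') ∧ (suc i ≡ᵇ i') ∧ (i' ≤ᵇ k) then 1
  else Δ (i , k) (i' , k')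

InS : ℕ → Partition → Set
InS n ps =
  All (λ x → 1 ≤ size x × ValidColour n (colour x)
             × ¬ (colour x ≡ (0 , 0))) ps
  × Linked (DiffCond Δ₁) ps
  × (∀ p k₁ ℓ₁ k₂ ℓ₂ → 1 ≤ p → k₁ < k₂ → ℓ₂ < k₁ → ℓ₁ ≤ ℓ₂ →
       ¬ Contains ps ((suc p , k₁ , ℓ₁) ∷ (p , k₂ , k₂) ∷ (p , k₂ , ℓ₂) ∷ []))
  × (∀ p k₁ ℓ₁ k₂ ℓ₂ → 1 ≤ p → ℓ₂ < ℓ₁ → k₁ < ℓ₂ → k₂ ≤ k₁ →
       ¬ Contains ps ((suc p , k₁ , ℓ₁) ∷ (suc p , ℓ₁ , ℓ₁) ∷ (p , k₂ , ℓ₂) ∷ []))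

-- Δ₁ differs from Δ only on three families of "exceptional" colour pairs (c, d),
-- where Δ(c, d) = 0 but Δ₁(c, d) = 1; so beyond the conditions of 𝒫_n, the
-- difference conditions with Δ₁ forbid exactly the ties p_c + p_d with (c, d)
-- exceptional.  With δ₁ and γ₁ every pattern forbidden in 𝒞_n contains such a tie,
-- except (c3) and (d3) when γ₁ takes its second value, and those are the two
-- patterns of the proposition.  Conversely, a tie in a partition of 𝒞_n is ruled
-- out by looking at its neighbour on the side of the bound colour: the condition
-- with Δ leaves a gap of 0, 1 or at least 2 to it (or there is no neighbour), and
-- each case is excluded by one of the patterns (a)-(d).

module Submission where

open import Defs
open import Data.Nat
  using (ℕ; zero; suc; _+_; _∸_; _≤_; _≰_; _<_; _⊔_; _⊓_; _≡ᵇ_; _<ᵇ_; _≤ᵇ_; z≤n; s≤s; s≤s⁻¹)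
open import Data.Nat.Properties
open import Data.Bool using (true; false; if_then_else_; _∧_; not; T)
open import Data.Bool.Properties using (T-≡; T-∧; if-cong; if-cong-else; if-eta)
open import Data.Product using (_×_; _,_; proj₁; proj₂; Σ)
open import Data.Sum using (_⊎_; inj₁; inj₂)
import Data.Sum as Sum
open import Data.List using ([]; _∷_; _++_; initLast; _∷ʳ′_)
open import Data.List.Properties using (++-assoc; ++-identityʳ)
open import Data.List.Relation.Unary.All using (All)
import Data.List.Relation.Unary.All as All
open import Data.List.Relation.Unary.Linked using (Linked; []; [-]; _∷_)
import Data.List.Relation.Unary.Linked as Linked
open import Function.Bundles using (Equivalence)
open import Function using (_∘′_)
open import Relation.Binary.PropositionalEquality
open import Relation.Nullary using (¬_; yes; no; contradiction)
open import Relation.Nullary.Decidable using (_×-dec_)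

≡ᵇ-refl : ∀ m → (m ≡ᵇ m) ≡ true
≡ᵇ-refl m = Equivalence.to T-≡ (≡⇒≡ᵇ m m refl)

¬T⇒≡false : ∀ {b} → ¬ T b → b ≡ false
¬T⇒≡false {false} _ = refl
¬T⇒≡false {true} ¬t = contradiction _ ¬t

≤ᵇ-true : ∀ {m n} → m ≤ n → (m ≤ᵇ n) ≡ true
≤ᵇ-true m≤n = Equivalence.to T-≡ (≤⇒≤ᵇ m≤n)

≤ᵇ-false : ∀ {m n} → n < m → (m ≤ᵇ n) ≡ false
≤ᵇ-false {m} {n} n<m = ¬T⇒≡false (<⇒≱ n<m ∘′ ≤ᵇ⇒≤ m n)

<ᵇ-true : ∀ {m n} → m < n → (m <ᵇ n) ≡ true
<ᵇ-true m<n = Equivalence.to T-≡ (<⇒<ᵇ m<n)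

<ᵇ-false : ∀ {m n} → n ≤ m → (m <ᵇ n) ≡ false
<ᵇ-false {m} {n} n≤m = ¬T⇒≡false (≤⇒≯ n≤m ∘′ <ᵇ⇒< m n)

≡ᵇ∧≡ᵇ-false : ∀ {m n o} → ¬ (m ≡ n × n ≡ o) → ((m ≡ᵇ n) ∧ (n ≡ᵇ o)) ≡ false
≡ᵇ∧≡ᵇ-false {m} {n} {o} ¬eqs = ¬T⇒≡false λ t →
  let (m≡n , n≡o) = Equivalence.to T-∧ t in ¬eqs (≡ᵇ⇒≡ m n m≡n , ≡ᵇ⇒≡ n o n≡o)

T-∧₄ : ∀ {a b c d} → T (a ∧ b ∧ c ∧ d) → T a × T b × T c × T d
T-∧₄ {true} {true} {true} {true} _ = _ , _ , _ , _

m+n≤m⇒n≡0 : ∀ m {n} → m + n ≤ m → n ≡ 0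
m+n≤m⇒n≡0 m {n} le = n≤0⇒n≡0 (+-cancelˡ-≤ m n 0 (subst (m + n ≤_) (sym (+-identityʳ m)) le))

m+2≰1+m : ∀ m → m + 2 ≰ suc m
m+2≰1+m m le = m+1+n≰m m (s≤s⁻¹ (subst (_≤ suc m) (+-suc m 1) le))

≤-gap : ∀ {p q} → p ≤ q → q ≡ p ⊎ q ≡ suc p ⊎ p + 2 ≤ q
≤-gap {q = zero} z≤n = inj₁ refl
≤-gap {q = suc zero} z≤n = inj₂ (inj₁ refl)
≤-gap {q = suc (suc q)} z≤n = inj₂ (inj₂ (s≤s (s≤s z≤n)))
≤-gap (s≤s p≤q) = Sum.map (cong suc) (Sum.map (cong suc) s≤s) (≤-gap p≤q)

⊔<⊓ : ∀ {a b c d} → a < c → a < d → b < c → b < d → a ⊔ b < c ⊓ d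
⊔<⊓ a<c a<d b<c b<d = ⊓-glb (⊔-lub a<c b<c) (⊔-lub a<d b<d)

-- Δ (i , k) (i' , k') reduces to Δᵃ i k i' + Δᵇ k i' k'.
Δᵃ : ℕ → ℕ → ℕ → ℕ
Δᵃ i k i' = χ (i' ≤ᵇ i) ∸ χ ((i ≡ᵇ k) ∧ (k ≡ᵇ i'))

Δᵇ : ℕ → ℕ → ℕ → ℕ
Δᵇ k i' k' = χ (k ≤ᵇ k') ∸ χ ((k ≡ᵇ i') ∧ (i' ≡ᵇ k'))

Δᵃ-< : ∀ {i k i'} → i < i' → Δᵃ i k i' ≡ 0
Δᵃ-< {i} {k} {i'} i<i' rewrite ≤ᵇ-false i<i' = 0∸n≡0 (χ ((i ≡ᵇ k) ∧ (k ≡ᵇ i')))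

Δᵃ-≥ : ∀ {i k i'} → i' ≤ i → ¬ (i ≡ k × k ≡ i') → Δᵃ i k i' ≡ 1
Δᵃ-≥ i'≤i ¬eqs rewrite ≤ᵇ-true i'≤i | ≡ᵇ∧≡ᵇ-false ¬eqs = refl

Δᵃ-diagonal : ∀ i → Δᵃ i i i ≡ 0
Δᵃ-diagonal i rewrite ≤ᵇ-true (≤-refl {i}) | ≡ᵇ-refl i = refl

Δᵇ-> : ∀ {k i' k'} → k' < k → Δᵇ k i' k' ≡ 0
Δᵇ-> {k} {i'} {k'} k'<k rewrite ≤ᵇ-false k'<k = 0∸n≡0 (χ ((k ≡ᵇ i') ∧ (i' ≡ᵇ k')))

Δᵇ-≤ : ∀ {k i' k'} → k ≤ k' → ¬ (k ≡ i' × i' ≡ k') → Δᵇ k i' k' ≡ 1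
Δᵇ-≤ k≤k' ¬eqs rewrite ≤ᵇ-true k≤k' | ≡ᵇ∧≡ᵇ-false ¬eqs = refl

Δᵇ-diagonal : ∀ i → Δᵇ i i i ≡ 0
Δᵇ-diagonal i rewrite ≤ᵇ-true (≤-refl {i}) | ≡ᵇ-refl i = refl

Δ-to-free≡0 : ∀ i k t → Δ (i , k) (t , t) ≡ 0 → (i ≡ t × k ≡ t) ⊎ (i < t × t ≤ k)
Δ-to-free≡0 i k t Δ≡0 with m+n≡0⇒m≡0 (Δᵃ i k t) Δ≡0 | m+n≡0⇒n≡0 (Δᵃ i k t) Δ≡0 | i <? t
... | _ | Δᵇ≡0 | yes i<t with k <? t
...   | yes k<t = contradiction (trans (sym Δᵇ≡0) (Δᵇ-≤ (<⇒≤ k<t) (<⇒≢ k<t ∘′ proj₁))) 0≢1+n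
...   | no k≮t = inj₂ (i<t , ≮⇒≥ k≮t)
Δ-to-free≡0 i k t Δ≡0 | Δᵃ≡0 | _ | no i≮t with (i ≟ k) ×-dec (k ≟ t)
...   | yes (i≡k , k≡t) = inj₁ (trans i≡k k≡t , k≡t)
...   | no ¬eqs = contradiction (trans (sym Δᵃ≡0) (Δᵃ-≥ (≮⇒≥ i≮t) ¬eqs)) 0≢1+n

Δ-from-free≡0 : ∀ t k ℓ → Δ (t , t) (k , ℓ) ≡ 0 → (k ≡ t × ℓ ≡ t) ⊎ (t ≤ k × ℓ < t)
Δ-from-free≡0 t k ℓ Δ≡0 with m+n≡0⇒m≡0 (Δᵃ t t k) Δ≡0 | m+n≡0⇒n≡0 (Δᵃ t t k) Δ≡0 | k <? t
... | Δᵃ≡0 | _ | yes k<t =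
  contradiction (trans (sym Δᵃ≡0) (Δᵃ-≥ (<⇒≤ k<t) (<⇒≢ k<t ∘′ sym ∘′ proj₂))) 0≢1+n
... | _ | Δᵇ≡0 | no k≮t with ℓ <? t
...   | yes ℓ<t = inj₂ (≮⇒≥ k≮t , ℓ<t)
...   | no ℓ≮t with (t ≟ k) ×-dec (k ≟ ℓ)
...     | yes (t≡k , k≡ℓ) = inj₁ (sym t≡k , sym (trans t≡k k≡ℓ))
...     | no ¬eqs = contradiction (trans (sym Δᵇ≡0) (Δᵇ-≤ (≮⇒≥ ℓ≮t) ¬eqs)) 0≢1+n

Δ-to-free≡2 : ∀ {k ℓ t} → ℓ < t → t ≤ k → Δ (k , ℓ) (t , t) ≡ 2
Δ-to-free≡2 ℓ<t t≤k =
  cong₂ _+_ (Δᵃ-≥ t≤k (<⇒≢ ℓ<t ∘′ proj₂)) (Δᵇ-≤ (<⇒≤ ℓ<t) (<⇒≢ ℓ<t ∘′ proj₁))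

Δ-from-free≡2 : ∀ {t k ℓ} → k < t → t ≤ ℓ → Δ (t , t) (k , ℓ) ≡ 2
Δ-from-free≡2 k<t t≤ℓ =
  cong₂ _+_ (Δᵃ-≥ (<⇒≤ k<t) (<⇒≢ k<t ∘′ sym ∘′ proj₂)) (Δᵇ-≤ t≤ℓ (<⇒≢ k<t ∘′ sym ∘′ proj₁))

-- The three special cases in the definition of Δ₁; m + 1 is the paper's ℓ in the
-- second and its k in the third.
data Exceptional : Colour → Colour → Set where
  free-free  : ∀ i → 0 < i → Exceptional (i , i) (i , i)
  free-bound : ∀ m k → suc m ≤ k → Exceptional (suc m , suc m) (k , m)
  bound-free : ∀ m ℓ → suc m ≤ ℓ → Exceptional (m , ℓ) (suc m , suc m)

Δ-exceptional : ∀ {c d} → Exceptional c d → Δ c d ≡ 0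
Δ-exceptional (free-free i _) = cong₂ _+_ (Δᵃ-diagonal i) (Δᵇ-diagonal i)
Δ-exceptional (free-bound m k m<k) with k ≟ suc m
... | yes refl = cong₂ _+_ (Δᵃ-diagonal (suc m)) (Δᵇ-> {suc m} {suc m} (n<1+n m))
... | no k≢1+m =
  cong₂ _+_ (Δᵃ-< {suc m} {suc m} (≤∧≢⇒< m<k (k≢1+m ∘′ sym))) (Δᵇ-> {suc m} {k} (n<1+n m))
Δ-exceptional (bound-free m ℓ m<ℓ) with ℓ ≟ suc m
... | yes refl = cong₂ _+_ (Δᵃ-< {m} {suc m} (n<1+n m)) (Δᵇ-diagonal (suc m))
... | no ℓ≢1+m =
  cong₂ _+_ (Δᵃ-< {m} {ℓ} (n<1+n m)) (Δᵇ-> {ℓ} {suc m} (≤∧≢⇒< m<ℓ (ℓ≢1+m ∘′ sym)))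

if-then-1 : ∀ b {x} → x ≡ 1 → (if b then 1 else x) ≡ 1
if-then-1 b x≡1 = trans (if-cong-else b x≡1) (if-eta b)

Δ₁-exceptional : ∀ {c d} → Exceptional c d → Δ₁ c d ≡ 1
Δ₁-exceptional (free-free i 0<i) rewrite ≡ᵇ-refl i | <ᵇ-true 0<i = refl
Δ₁-exceptional (free-bound m k m<k) rewrite ≡ᵇ-refl m | ≤ᵇ-true m<k = if-then-1 _ refl
Δ₁-exceptional (bound-free m ℓ m<ℓ) rewrite ≡ᵇ-refl m | ≤ᵇ-true m<ℓ =
  if-then-1 ((m ≡ᵇ ℓ) ∧ (m ≡ᵇ suc m) ∧ (0 <ᵇ m))
    (if-then-1 ((m ≡ᵇ ℓ) ∧ (0 <ᵇ m) ∧ (suc (suc m) ≡ᵇ m) ∧ (m ≤ᵇ suc m)) refl)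

free-free′ : ∀ {i k i' k'} → i ≡ k → i' ≡ k' → i ≡ i' → 0 < i → Exceptional (i , k) (i' , k')
free-free′ refl refl refl 0<i = free-free _ 0<i

free-bound′ : ∀ {i k i' k'} → i ≡ k → suc k' ≡ i → i ≤ i' → Exceptional (i , k) (i' , k')
free-bound′ refl refl = free-bound _ _

bound-free′ : ∀ {i k i' k'} → i' ≡ k' → suc i ≡ i' → i' ≤ k → Exceptional (i , k) (i' , k')
bound-free′ refl refl = bound-free _ _

Δ₁≡Δ⊎exceptional : ∀ c d → Δ₁ c d ≡ Δ c d ⊎ Exceptional c d
Δ₁≡Δ⊎exceptional (i , k) (i' , k')
  with (i ≡ᵇ k) ∧ (i' ≡ᵇ k') ∧ (i ≡ᵇ i') ∧ (0 <ᵇ i) in e₁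
... | true =
  let (i≡k , i'≡k' , i≡i' , 0<i) = T-∧₄ (Equivalence.from T-≡ e₁) in
  inj₂ (free-free′ (≡ᵇ⇒≡ i k i≡k) (≡ᵇ⇒≡ i' k' i'≡k') (≡ᵇ⇒≡ i i' i≡i') (<ᵇ⇒< 0 i 0<i))
... | false with (i ≡ᵇ k) ∧ (0 <ᵇ i) ∧ (suc k' ≡ᵇ i) ∧ (i ≤ᵇ i') in e₂
...   | true =
  let (i≡k , _ , k'+1≡i , i≤i') = T-∧₄ {b = 0 <ᵇ i} (Equivalence.from T-≡ e₂) in
  inj₂ (free-bound′ (≡ᵇ⇒≡ i k i≡k) (≡ᵇ⇒≡ (suc k') i k'+1≡i) (≤ᵇ⇒≤ i i' i≤i'))
...   | false with (i' ≡ᵇ k') ∧ (0 <ᵇ i') ∧ (suc i ≡ᵇ i') ∧ (i' ≤ᵇ k) in e₃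
...     | true =
  let (i'≡k' , _ , i+1≡i' , i'≤k) = T-∧₄ {b = 0 <ᵇ i'} (Equivalence.from T-≡ e₃) in
  inj₂ (bound-free′ (≡ᵇ⇒≡ i' k' i'≡k') (≡ᵇ⇒≡ (suc i) i' i+1≡i') (≤ᵇ⇒≤ i' k i'≤k))
...     | false = inj₁ refl

Δ≤Δ₁ : ∀ c d → Δ c d ≤ Δ₁ c d
Δ≤Δ₁ c d with Δ₁≡Δ⊎exceptional c d
... | inj₁ Δ₁≡Δ = ≤-reflexive (sym Δ₁≡Δ)
... | inj₂ ex = subst (_≤ Δ₁ c d) (sym (Δ-exceptional ex)) z≤n

DiffCond-Δ₁⇒Δ : ∀ {x y} → DiffCond Δ₁ x y → DiffCond Δ x y
DiffCond-Δ₁⇒Δ {_ , c} {q , d} = ≤-trans (+-monoʳ-≤ q (Δ≤Δ₁ c d))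

δ₁≡1+ℓ : ∀ {k ℓ} → ℓ < k → δ₁ k ℓ ≡ suc ℓ
δ₁≡1+ℓ ℓ<k = cong suc (m≥n⇒m⊓n≡n (<⇒≤ ℓ<k))

δ₁≡1+k : ∀ {k ℓ} → k < ℓ → δ₁ k ℓ ≡ suc k
δ₁≡1+k k<ℓ = cong suc (m≤n⇒m⊓n≡m (<⇒≤ k<ℓ))

inRange-false : ∀ {j a b} → ¬ (a < j × j ≤ b) → inRange j a b ≡ false
inRange-false {j} {a} {b} ∉ = ¬T⇒≡false λ t →
  let (a<j , j≤b) = Equivalence.to T-∧ t in ∉ (<ᵇ⇒< a j a<j , ≤ᵇ⇒≤ j b j≤b)

inRange-true : ∀ {j a b} → a < j → j ≤ b → inRange j a b ≡ true
inRange-true a<j j≤b rewrite <ᵇ-true a<j = ≤ᵇ-true j≤b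

γ₁-b : ∀ {k₁ ℓ₁ k₂ ℓ₂} → k₁ ⊔ ℓ₂ < k₂ ⊓ ℓ₁ → γ₁ k₁ ℓ₁ k₂ ℓ₂ ≡ suc (k₁ ⊔ ℓ₂)
γ₁-b lt = if-cong (<ᵇ-true lt)

γ₁-c : ∀ {k₁ ℓ₁ k₂ ℓ₂} → ℓ₁ < k₁ → ℓ₂ < k₂ →
  γ₁ k₁ ℓ₁ k₂ ℓ₂ ≡ (if not (inRange (suc ℓ₂) ℓ₁ k₁) then suc ℓ₂ else k₂)
γ₁-c {k₁} {ℓ₁} {k₂} {ℓ₂} ℓ₁<k₁ ℓ₂<k₂
  rewrite <ᵇ-false (≤-trans (m⊓n≤n k₂ ℓ₁) (≤-trans (<⇒≤ ℓ₁<k₁) (m≤m⊔n k₁ ℓ₂)))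
        | <ᵇ-true ℓ₁<k₁ | <ᵇ-true ℓ₂<k₂ = refl

γ₁-d : ∀ {k₁ ℓ₁ k₂ ℓ₂} → k₁ < ℓ₁ → k₂ < ℓ₂ →
  γ₁ k₁ ℓ₁ k₂ ℓ₂ ≡ (if not (inRange (suc k₁) k₂ ℓ₂) then suc k₁ else ℓ₁)
γ₁-d {k₁} {ℓ₁} {k₂} {ℓ₂} k₁<ℓ₁ k₂<ℓ₂
  rewrite <ᵇ-false (≤-trans (m⊓n≤m k₂ ℓ₁) (≤-trans (<⇒≤ k₂<ℓ₂) (m≤n⊔m k₁ ℓ₂)))
        | <ᵇ-false (<⇒≤ k₁<ℓ₁) | <ᵇ-true k₁<ℓ₁ | <ᵇ-true k₂<ℓ₂ = refl

γ₁-c-low : ∀ {k₁ ℓ₁ k₂ ℓ₂} → ℓ₁ < k₁ → ℓ₂ < k₂ → ¬ (ℓ₁ < suc ℓ₂ × suc ℓ₂ ≤ k₁) →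
  γ₁ k₁ ℓ₁ k₂ ℓ₂ ≡ suc ℓ₂
γ₁-c-low ℓ₁<k₁ ℓ₂<k₂ ∉ rewrite γ₁-c ℓ₁<k₁ ℓ₂<k₂ | inRange-false ∉ = refl

γ₁-c-high : ∀ {k₁ ℓ₁ k₂ ℓ₂} → ℓ₂ < k₂ → ℓ₁ < suc ℓ₂ → suc ℓ₂ ≤ k₁ → γ₁ k₁ ℓ₁ k₂ ℓ₂ ≡ k₂
γ₁-c-high ℓ₂<k₂ ℓ₁<1+ℓ₂ ℓ₂<k₁
  rewrite γ₁-c (<-≤-trans ℓ₁<1+ℓ₂ ℓ₂<k₁) ℓ₂<k₂ | inRange-true ℓ₁<1+ℓ₂ ℓ₂<k₁ = refl

γ₁-d-low : ∀ {k₁ ℓ₁ k₂ ℓ₂} → k₁ < ℓ₁ → k₂ < ℓ₂ → ¬ (k₂ < suc k₁ × suc k₁ ≤ ℓ₂) →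
  γ₁ k₁ ℓ₁ k₂ ℓ₂ ≡ suc k₁
γ₁-d-low k₁<ℓ₁ k₂<ℓ₂ ∉ rewrite γ₁-d k₁<ℓ₁ k₂<ℓ₂ | inRange-false ∉ = refl

γ₁-d-high : ∀ {k₁ ℓ₁ k₂ ℓ₂} → k₁ < ℓ₁ → k₂ < suc k₁ → suc k₁ ≤ ℓ₂ → γ₁ k₁ ℓ₁ k₂ ℓ₂ ≡ ℓ₁
γ₁-d-high k₁<ℓ₁ k₂<1+k₁ k₁<ℓ₂
  rewrite γ₁-d k₁<ℓ₁ (<-≤-trans k₂<1+k₁ k₁<ℓ₂) | inRange-true k₂<1+k₁ k₁<ℓ₂ = refl

Linked-consecutive : ∀ {R : Part → Part → Set} {ps x y} →
  Linked R ps → Contains ps (x ∷ y ∷ []) → R x y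
Linked-consecutive rs ([] , _ , refl) = Linked.head rs
Linked-consecutive rs (_ ∷ xs , ys , refl) = Linked-consecutive (Linked.tail rs) (xs , ys , refl)

consecutive⇒Linked : ∀ {R : Part → Part → Set} ps →
  (∀ {x y} → Contains ps (x ∷ y ∷ []) → R x y) → Linked R ps
consecutive⇒Linked [] _ = []
consecutive⇒Linked (_ ∷ []) _ = [-]
consecutive⇒Linked (x ∷ y ∷ zs) r =
  r ([] , zs , refl) ∷
  consecutive⇒Linked (y ∷ zs) λ (xs , ys , eq) → r (x ∷ xs , ys , cong (x ∷_) eq)

All-Contains : ∀ {P : Part → Set} {ps x π} → All P ps → Contains ps (x ∷ π) → P x
All-Contains ps ([] , _ , refl) = All.head ps
All-Contains ps (_ ∷ xs , ys , refl) = All-Contains (All.tail ps) (xs , ys , refl)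

Contains-tail : ∀ {ps x π} → Contains ps (x ∷ π) → Contains ps π
Contains-tail {x = x} {π} (xs , ys , refl) =
  xs ++ x ∷ [] , ys , sym (++-assoc xs (x ∷ []) (π ++ ys))

Contains-prefix₂ : ∀ {ps x y π} → Contains ps (x ∷ y ∷ π) → Contains ps (x ∷ y ∷ [])
Contains-prefix₂ {π = π} (xs , ys , eq) = xs , π ++ ys , eq

Begins⇒Contains : ∀ {ps π} → Begins ps π → Contains ps π
Begins⇒Contains (ys , eq) = [] , ys , eq

Ends⇒Contains : ∀ {ps π} → Ends ps π → Contains ps π
Ends⇒Contains {π = π} (xs , refl) = xs , [] , cong (xs ++_) (sym (++-identityʳ π))

Contains-preceded : ∀ {ps x y} → Contains ps (x ∷ y ∷ []) →
  Begins ps (x ∷ y ∷ []) ⊎ Σ Part λ w → Contains ps (w ∷ x ∷ y ∷ [])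
Contains-preceded (xs , ys , eq) with initLast xs
... | [] = inj₁ (ys , eq)
... | ws ∷ʳ′ w = inj₂ (w , ws , ys , trans eq (++-assoc ws (w ∷ []) _))

Contains-followed : ∀ {ps x y} → Contains ps (x ∷ y ∷ []) →
  Ends ps (x ∷ y ∷ []) ⊎ Σ Part λ z → Contains ps (x ∷ y ∷ z ∷ [])
Contains-followed (xs , [] , eq) = inj₁ (xs , eq)
Contains-followed (xs , z ∷ ys , eq) = inj₂ (z , xs , ys , eq)

module _ {ps : Partition} {p : ℕ} {g g' : ℕ} (g≡g' : g ≡ g') where

  recolour-head : ∀ {y} → Begins ps ((p , g , g) ∷ y ∷ []) → Begins ps ((p , g' , g') ∷ y ∷ [])
  recolour-head {y} = subst (λ h → Begins ps ((p , h , h) ∷ y ∷ [])) g≡g'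

  recolour-middle : ∀ {x y} →
    Contains ps (x ∷ (p , g , g) ∷ y ∷ []) → Contains ps (x ∷ (p , g' , g') ∷ y ∷ [])
  recolour-middle {x} {y} = subst (λ h → Contains ps (x ∷ (p , h , h) ∷ y ∷ [])) g≡g'

  recolour-last : ∀ {x} → Ends ps (x ∷ (p , g , g) ∷ []) → Ends ps (x ∷ (p , g' , g') ∷ [])
  recolour-last {x} = subst (λ h → Ends ps (x ∷ (p , h , h) ∷ [])) g≡g'

AvoidS₁ : Partition → Set
AvoidS₁ ps = ∀ p k₁ ℓ₁ k₂ ℓ₂ → 1 ≤ p → k₁ < k₂ → ℓ₂ < k₁ → ℓ₁ ≤ ℓ₂ →
  ¬ Contains ps ((suc p , k₁ , ℓ₁) ∷ (p , k₂ , k₂) ∷ (p , k₂ , ℓ₂) ∷ [])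

AvoidS₂ : Partition → Set
AvoidS₂ ps = ∀ p k₁ ℓ₁ k₂ ℓ₂ → 1 ≤ p → ℓ₂ < ℓ₁ → k₁ < ℓ₂ → k₂ ≤ k₁ →
  ¬ Contains ps ((suc p , k₁ , ℓ₁) ∷ (suc p , ℓ₁ , ℓ₁) ∷ (p , k₂ , ℓ₂) ∷ [])

module WithinC {n : ℕ} {ps : Partition}
  (parts : All (λ x → 1 ≤ size x × ValidColour n (colour x)) ps)
  (linked : Linked (DiffCond Δ) ps)
  (avoidA : AvoidA δ₁ γ₁ ps) (avoidB : AvoidB δ₁ γ₁ ps)
  (avoidC1 : AvoidC1 δ₁ γ₁ ps) (avoidC1∞ : AvoidC1∞ δ₁ γ₁ ps)
  (avoidC2 : AvoidC2 δ₁ γ₁ ps) (avoidC3 : AvoidC3 δ₁ γ₁ ps)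
  (avoidD1 : AvoidD1 δ₁ γ₁ ps) (avoidD1∞ : AvoidD1∞ δ₁ γ₁ ps)
  (avoidD2 : AvoidD2 δ₁ γ₁ ps) (avoidD3 : AvoidD3 δ₁ γ₁ ps)
  where

  positive : ∀ {p c π} → Contains ps ((p , c) ∷ π) → 1 ≤ p
  positive h = proj₁ (All-Contains parts h)

  gap : ∀ {x y π} → Contains ps (x ∷ y ∷ π) → DiffCond Δ x y
  gap h = Linked-consecutive linked (Contains-prefix₂ h)

  free-bound-level : ∀ {m k} → m < k → ∀ {p k₁ ℓ₁} →
    ¬ Contains ps ((p , k₁ , ℓ₁) ∷ (p , suc m , suc m) ∷ (p , k , m) ∷ [])
  free-bound-level {m} {k} m<k {p} {k₁} {ℓ₁} h
    with Δ-to-free≡0 k₁ ℓ₁ (suc m) (m+n≤m⇒n≡0 p (gap h))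
  ... | inj₁ (refl , refl) = avoidA p (suc m) (positive h) (s≤s z≤n) (Contains-prefix₂ h)
  ... | inj₂ (k₁<1+m , m<ℓ₁) = avoidB p k₁ ℓ₁ k m (positive h) lt (recolour-middle (sym γ≡1+m) h)
    where
    lt : k₁ ⊔ m < k ⊓ ℓ₁
    lt = ⊔<⊓ (<-≤-trans k₁<1+m m<k) (<-≤-trans k₁<1+m m<ℓ₁) m<k m<ℓ₁
    γ≡1+m : γ₁ k₁ ℓ₁ k m ≡ suc m
    γ≡1+m = trans (γ₁-b {k₁} {ℓ₁} {k} {m} lt) (cong suc (m≤n⇒m⊔n≡n (≤-pred k₁<1+m)))

  free-bound-drop : ∀ {m k} → m < k → ∀ {p k₁ ℓ₁} →
    ¬ Contains ps ((suc p , k₁ , ℓ₁) ∷ (p , suc m , suc m) ∷ (p , k , m) ∷ [])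
  free-bound-drop {m} {k} m<k {p} {k₁} {ℓ₁} h with k₁ ≤? ℓ₁
  ... | yes k₁≤ℓ₁ = avoidC2 p k₁ ℓ₁ k m (positive (Contains-tail h)) m<k k₁≤ℓ₁
                      (recolour-middle (sym (δ₁≡1+ℓ m<k)) h)
  ... | no k₁≰ℓ₁ with (ℓ₁ <? suc m) ×-dec (suc m ≤? k₁)
  ...   | yes (ℓ₁<1+m , m<k₁) =
    m+2≰1+m p (subst (λ d → p + d ≤ suc p) (Δ-to-free≡2 ℓ₁<1+m m<k₁) (gap h))
  ...   | no ∉ = avoidC3 p k₁ ℓ₁ k m (positive (Contains-tail h)) m<k (≰⇒> k₁≰ℓ₁)
                  (suc m , ≤-refl , m<k , ∉) (recolour-middle (sym (γ₁-c-low (≰⇒> k₁≰ℓ₁) m<k ∉)) h)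

  free-bound-preceded : ∀ {m k} → m < k → ∀ {p q k₁ ℓ₁} →
    ¬ Contains ps ((q , k₁ , ℓ₁) ∷ (p , suc m , suc m) ∷ (p , k , m) ∷ [])
  free-bound-preceded {m} {k} m<k {p} {q} {k₁} {ℓ₁} h with ≤-gap (m+n≤o⇒m≤o p (gap h))
  ... | inj₁ refl = free-bound-level m<k h
  ... | inj₂ (inj₁ refl) = free-bound-drop m<k h
  ... | inj₂ (inj₂ p+2≤q) = avoidC1 p q (k₁ , ℓ₁) k m (positive (Contains-tail h)) m<k p+2≤q
                              (recolour-middle (sym (δ₁≡1+ℓ m<k)) h)

  bound-free-level : ∀ {m ℓ} → m < ℓ → ∀ {p k₂ ℓ₂} →
    ¬ Contains ps ((p , m , ℓ) ∷ (p , suc m , suc m) ∷ (p , k₂ , ℓ₂) ∷ [])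
  bound-free-level {m} {ℓ} m<ℓ {p} {k₂} {ℓ₂} h
    with Δ-from-free≡0 (suc m) k₂ ℓ₂ (m+n≤m⇒n≡0 p (gap (Contains-tail h)))
  ... | inj₁ (refl , refl) = avoidA p (suc m) (positive h) (s≤s z≤n) (Contains-tail h)
  ... | inj₂ (m<k₂ , ℓ₂<1+m) = avoidB p m ℓ k₂ ℓ₂ (positive h) lt (recolour-middle (sym γ≡1+m) h)
    where
    lt : m ⊔ ℓ₂ < k₂ ⊓ ℓ
    lt = ⊔<⊓ m<k₂ m<ℓ (<-≤-trans ℓ₂<1+m m<k₂) (<-≤-trans ℓ₂<1+m m<ℓ)
    γ≡1+m : γ₁ m ℓ k₂ ℓ₂ ≡ suc m
    γ≡1+m = trans (γ₁-b {m} {ℓ} {k₂} {ℓ₂} lt) (cong suc (m≥n⇒m⊔n≡m (≤-pred ℓ₂<1+m)))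

  bound-free-drop : ∀ {m ℓ} → m < ℓ → ∀ {r k₂ ℓ₂} →
    ¬ Contains ps ((suc r , m , ℓ) ∷ (suc r , suc m , suc m) ∷ (r , k₂ , ℓ₂) ∷ [])
  bound-free-drop {m} {ℓ} m<ℓ {r} {k₂} {ℓ₂} h with ℓ₂ ≤? k₂
  ... | yes ℓ₂≤k₂ = avoidD2 r m ℓ k₂ ℓ₂ (positive (Contains-tail (Contains-tail h))) m<ℓ ℓ₂≤k₂
                      (recolour-middle (sym (δ₁≡1+k m<ℓ)) h)
  ... | no ℓ₂≰k₂ with (k₂ <? suc m) ×-dec (suc m ≤? ℓ₂)
  ...   | yes (k₂<1+m , m<ℓ₂) =
    m+2≰1+m r (subst (λ d → r + d ≤ suc r) (Δ-from-free≡2 k₂<1+m m<ℓ₂) (gap (Contains-tail h)))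
  ...   | no ∉ = avoidD3 r m ℓ k₂ ℓ₂ (positive (Contains-tail (Contains-tail h))) m<ℓ (≰⇒> ℓ₂≰k₂)
                  (suc m , ≤-refl , m<ℓ , ∉) (recolour-middle (sym (γ₁-d-low m<ℓ (≰⇒> ℓ₂≰k₂) ∉)) h)

  bound-free-followed : ∀ {m ℓ} → m < ℓ → ∀ {p r k₂ ℓ₂} →
    ¬ Contains ps ((p , m , ℓ) ∷ (p , suc m , suc m) ∷ (r , k₂ , ℓ₂) ∷ [])
  bound-free-followed {m} {ℓ} m<ℓ {p} {r} {k₂} {ℓ₂} h
    with ≤-gap (m+n≤o⇒m≤o r (gap (Contains-tail h)))
  ... | inj₁ refl = bound-free-level m<ℓ h
  ... | inj₂ (inj₁ refl) = bound-free-drop m<ℓ h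
  ... | inj₂ (inj₂ r+2≤p) = avoidD1 p r m ℓ (k₂ , ℓ₂) (positive h) m<ℓ r+2≤p
                              (recolour-middle (sym (δ₁≡1+k m<ℓ)) h)

  ¬tied-exceptional : ∀ {c d} → Exceptional c d → ∀ {p} → ¬ Contains ps ((p , c) ∷ (p , d) ∷ [])
  ¬tied-exceptional (free-free i 0<i) h = avoidA _ i (positive h) 0<i h
  ¬tied-exceptional (free-bound m k m<k) h with Contains-preceded h
  ... | inj₁ begins = avoidC1∞ _ k m (positive h) m<k (recolour-head (sym (δ₁≡1+ℓ m<k)) begins)
  ... | inj₂ (_ , h₃) = free-bound-preceded m<k h₃
  ¬tied-exceptional (bound-free m ℓ m<ℓ) h with Contains-followed h
  ... | inj₁ ends = avoidD1∞ _ m ℓ (positive h) m<ℓ (recolour-last (sym (δ₁≡1+k m<ℓ)) ends)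
  ... | inj₂ (_ , h₃) = bound-free-followed m<ℓ h₃

  consecutive-Δ₁ : ∀ {x y} → Contains ps (x ∷ y ∷ []) → DiffCond Δ₁ x y
  consecutive-Δ₁ {p , c} {p' , d} h with Δ₁≡Δ⊎exceptional c d
  ... | inj₁ Δ₁≡Δ = subst (λ e → p' + e ≤ p) (sym Δ₁≡Δ) (gap h)
  ... | inj₂ ex rewrite Δ₁-exceptional ex = subst (_≤ p) (+-comm 1 p') p'<p
    where
    p'<p : p' < p
    p'<p = ≤∧≢⇒< (m+n≤o⇒m≤o p' (gap h)) λ { refl → ¬tied-exceptional ex h }

  avoidS₁ : AvoidS₁ ps
  avoidS₁ p k₁ ℓ₁ k₂ ℓ₂ 1≤p k₁<k₂ ℓ₂<k₁ ℓ₁≤ℓ₂ h =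
    avoidC3 p k₁ ℓ₁ k₂ ℓ₂ 1≤p ℓ₂<k₂ (≤-<-trans ℓ₁≤ℓ₂ ℓ₂<k₁)
      (k₂ , ℓ₂<k₂ , ≤-refl , λ (_ , k₂≤k₁) → <⇒≱ k₁<k₂ k₂≤k₁)
      (recolour-middle (sym (γ₁-c-high ℓ₂<k₂ (s≤s ℓ₁≤ℓ₂) ℓ₂<k₁)) h)
    where
    ℓ₂<k₂ : ℓ₂ < k₂
    ℓ₂<k₂ = <-trans ℓ₂<k₁ k₁<k₂

  avoidS₂ : AvoidS₂ ps
  avoidS₂ p k₁ ℓ₁ k₂ ℓ₂ 1≤p ℓ₂<ℓ₁ k₁<ℓ₂ k₂≤k₁ h =
    avoidD3 p k₁ ℓ₁ k₂ ℓ₂ 1≤p k₁<ℓ₁ (≤-<-trans k₂≤k₁ k₁<ℓ₂)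
      (ℓ₁ , k₁<ℓ₁ , ≤-refl , λ (_ , ℓ₁≤ℓ₂) → <⇒≱ ℓ₂<ℓ₁ ℓ₁≤ℓ₂)
      (recolour-middle (sym (γ₁-d-high k₁<ℓ₁ (s≤s k₂≤k₁) k₁<ℓ₂)) h)
    where
    k₁<ℓ₁ : k₁ < ℓ₁
    k₁<ℓ₁ = <-trans k₁<ℓ₂ ℓ₂<ℓ₁

module WithinS {ps : Partition} (linked : Linked (DiffCond Δ₁) ps)
  (avoidS₁ : AvoidS₁ ps) (avoidS₂ : AvoidS₂ ps) where

  ¬tied-exceptional : ∀ {c d} → Exceptional c d → ∀ {p} → ¬ Contains ps ((p , c) ∷ (p , d) ∷ [])
  ¬tied-exceptional ex {p} h =
    m+1+n≰m p (subst (λ e → p + e ≤ p) (Δ₁-exceptional ex) (Linked-consecutive linked h))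

  avoidA : AvoidA δ₁ γ₁ ps
  avoidA _ i _ 0<i = ¬tied-exceptional (free-free i 0<i)

  avoidB : AvoidB δ₁ γ₁ ps
  avoidB _ k₁ ℓ₁ k₂ ℓ₂ _ lt h with ℓ₂ ≤? k₁
  ... | yes ℓ₂≤k₁ =
    ¬tied-exceptional (bound-free k₁ ℓ₁ k₁<ℓ₁) (Contains-prefix₂ (recolour-middle γ≡1+k₁ h))
    where
    k₁<ℓ₁ : k₁ < ℓ₁
    k₁<ℓ₁ = ≤-<-trans (m≤m⊔n k₁ ℓ₂) (<-≤-trans lt (m⊓n≤n k₂ ℓ₁))
    γ≡1+k₁ : γ₁ k₁ ℓ₁ k₂ ℓ₂ ≡ suc k₁
    γ≡1+k₁ = trans (γ₁-b {k₁} {ℓ₁} {k₂} {ℓ₂} lt) (cong suc (m≥n⇒m⊔n≡m ℓ₂≤k₁))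
  ... | no ℓ₂≰k₁ =
    ¬tied-exceptional (free-bound ℓ₂ k₂ ℓ₂<k₂) (Contains-tail (recolour-middle γ≡1+ℓ₂ h))
    where
    ℓ₂<k₂ : ℓ₂ < k₂
    ℓ₂<k₂ = ≤-<-trans (m≤n⊔m k₁ ℓ₂) (<-≤-trans lt (m⊓n≤m k₂ ℓ₁))
    γ≡1+ℓ₂ : γ₁ k₁ ℓ₁ k₂ ℓ₂ ≡ suc ℓ₂
    γ≡1+ℓ₂ = trans (γ₁-b {k₁} {ℓ₁} {k₂} {ℓ₂} lt) (cong suc (m≤n⇒m⊔n≡n (<⇒≤ (≰⇒> ℓ₂≰k₁))))

  avoidC1 : AvoidC1 δ₁ γ₁ ps
  avoidC1 _ _ _ k₂ ℓ₂ _ ℓ₂<k₂ _ h =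
    ¬tied-exceptional (free-bound ℓ₂ k₂ ℓ₂<k₂) (Contains-tail (recolour-middle (δ₁≡1+ℓ ℓ₂<k₂) h))

  avoidC1∞ : AvoidC1∞ δ₁ γ₁ ps
  avoidC1∞ _ k₂ ℓ₂ _ ℓ₂<k₂ b =
    ¬tied-exceptional (free-bound ℓ₂ k₂ ℓ₂<k₂) (Begins⇒Contains (recolour-head (δ₁≡1+ℓ ℓ₂<k₂) b))

  avoidC2 : AvoidC2 δ₁ γ₁ ps
  avoidC2 _ _ _ k₂ ℓ₂ _ ℓ₂<k₂ _ h =
    ¬tied-exceptional (free-bound ℓ₂ k₂ ℓ₂<k₂) (Contains-tail (recolour-middle (δ₁≡1+ℓ ℓ₂<k₂) h))

  avoidC3 : AvoidC3 δ₁ γ₁ ps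
  avoidC3 p k₁ ℓ₁ k₂ ℓ₂ 1≤p ℓ₂<k₂ ℓ₁<k₁ (j , ℓ₂<j , j≤k₂ , j∉) h
    with (ℓ₁ <? suc ℓ₂) ×-dec (suc ℓ₂ ≤? k₁)
  ... | no ∉ = ¬tied-exceptional (free-bound ℓ₂ k₂ ℓ₂<k₂)
                 (Contains-tail (recolour-middle (γ₁-c-low ℓ₁<k₁ ℓ₂<k₂ ∉) h))
  ... | yes (ℓ₁<1+ℓ₂ , ℓ₂<k₁) =
    avoidS₁ p k₁ ℓ₁ k₂ ℓ₂ 1≤p k₁<k₂ ℓ₂<k₁ (≤-pred ℓ₁<1+ℓ₂)
      (recolour-middle (γ₁-c-high ℓ₂<k₂ ℓ₁<1+ℓ₂ ℓ₂<k₁) h)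
    where
    k₁<k₂ : k₁ < k₂
    k₁<k₂ = <-≤-trans (≰⇒> λ j≤k₁ → j∉ (≤-<-trans (≤-pred ℓ₁<1+ℓ₂) ℓ₂<j , j≤k₁)) j≤k₂

  avoidD1 : AvoidD1 δ₁ γ₁ ps
  avoidD1 _ _ k₁ ℓ₁ _ _ k₁<ℓ₁ _ h =
    ¬tied-exceptional (bound-free k₁ ℓ₁ k₁<ℓ₁) (Contains-prefix₂ (recolour-middle (δ₁≡1+k k₁<ℓ₁) h))

  avoidD1∞ : AvoidD1∞ δ₁ γ₁ ps
  avoidD1∞ _ k₁ ℓ₁ _ k₁<ℓ₁ e =
    ¬tied-exceptional (bound-free k₁ ℓ₁ k₁<ℓ₁) (Ends⇒Contains (recolour-last (δ₁≡1+k k₁<ℓ₁) e))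

  avoidD2 : AvoidD2 δ₁ γ₁ ps
  avoidD2 _ k₁ ℓ₁ _ _ _ k₁<ℓ₁ _ h =
    ¬tied-exceptional (bound-free k₁ ℓ₁ k₁<ℓ₁) (Contains-prefix₂ (recolour-middle (δ₁≡1+k k₁<ℓ₁) h))

  avoidD3 : AvoidD3 δ₁ γ₁ ps
  avoidD3 p k₁ ℓ₁ k₂ ℓ₂ 1≤p k₁<ℓ₁ k₂<ℓ₂ (j , k₁<j , j≤ℓ₁ , j∉) h
    with (k₂ <? suc k₁) ×-dec (suc k₁ ≤? ℓ₂)
  ... | no ∉ = ¬tied-exceptional (bound-free k₁ ℓ₁ k₁<ℓ₁)
                 (Contains-prefix₂ (recolour-middle (γ₁-d-low k₁<ℓ₁ k₂<ℓ₂ ∉) h))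
  ... | yes (k₂<1+k₁ , k₁<ℓ₂) =
    avoidS₂ p k₁ ℓ₁ k₂ ℓ₂ 1≤p ℓ₂<ℓ₁ k₁<ℓ₂ (≤-pred k₂<1+k₁)
      (recolour-middle (γ₁-d-high k₁<ℓ₁ k₂<1+k₁ k₁<ℓ₂) h)
    where
    ℓ₂<ℓ₁ : ℓ₂ < ℓ₁
    ℓ₂<ℓ₁ = <-≤-trans (≰⇒> λ j≤ℓ₂ → j∉ (≤-<-trans (≤-pred k₂<1+k₁) k₁<j , j≤ℓ₂)) j≤ℓ₁

InC⇒InS : ∀ n ps → InC n δ₁ γ₁ ps → InS n ps
InC⇒InS n ps
  ((parts , linked) , nonzero , aA , aB , aC1 , aC1∞ , aC2 , aC3 , aD1 , aD1∞ , aD2 , aD3) =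
  All.zipWith (λ { ((1≤p , valid) , c≢0) → 1≤p , valid , c≢0 }) (parts , nonzero) ,
  consecutive⇒Linked ps C.consecutive-Δ₁ , C.avoidS₁ , C.avoidS₂
  where
  module C = WithinC parts linked aA aB aC1 aC1∞ aC2 aC3 aD1 aD1∞ aD2 aD3

InS⇒InC : ∀ n ps → InS n ps → InC n δ₁ γ₁ ps
InS⇒InC n ps (parts , linked , avoidS₁ , avoidS₂) =
  (All.map (λ (1≤p , valid , _) → 1≤p , valid) parts ,
   Linked.map (λ {x} {y} → DiffCond-Δ₁⇒Δ {x} {y}) linked) ,
  All.map (λ (_ , _ , c≢0) → c≢0) parts ,
  S.avoidA , S.avoidB , S.avoidC1 , S.avoidC1∞ , S.avoidC2 , S.avoidC3 ,
  S.avoidD1 , S.avoidD1∞ , S.avoidD2 , S.avoidD3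
  where
  module S = WithinS linked avoidS₁ avoidS₂

proposition1p21 : (n : ℕ) → 1 ≤ n → (ps : Partition) →
    (InC n δ₁ γ₁ ps → InS n ps) × (InS n ps → InC n δ₁ γ₁ ps)
proposition1p21 n _ ps = InC⇒InS n ps , InS⇒InC n ps
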